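{- Let $b\ge2$ and let $f:\{0,1\}^b\to\{0,1\}$ satisfy $f(0)=0$ and $f(e_i)=1$ for every standard basis vector $e_i$, $i\in[b]$. Then for every $1\le i<j\le b$, the coefficient $c_{ij}$ of $x_ix_j$ in the multilinear polynomial expansion of $f$ satisfies $c_{ij}\in\{ -1,-2\}$. -}

module Defs where

open import Data.Bool using (Bool; true; false; if_then_else_)
open import Data.Nat using (ℕ; zero; suc)
open import Data.Integer using (ℤ; +_; -_; _+_; _*_)
open import Data.Vec using (Vec; []; _∷_; replicate)
open import Data.Fin using (Fin)
open import Data.Fin.Subset using (Subset; ⁅_⁆; _∪_)

-- A Boolean function on the hypercube {0,1}^b, with points encoded as
-- Vec Bool b (true = 1, false = 0).  Subsets of [b] are identified with
-- their indicator vectors (Data.Fin.Subset: Subset b = Vec Bool b).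

bit : Bool → ℤ
bit true  = + 1
bit false = + 0

sgn : Bool → ℤ
sgn false = + 1
sgn true  = - (+ 1)

mobius : ∀ {b} → Subset b → (Vec Bool b → ℤ) → ℤ
mobius {zero}  []          g = g []
mobius {suc b} (false ∷ S) g = mobius S (λ T → g (false ∷ T))
mobius {suc b} (true  ∷ S) g =
  mobius S (λ T → g (true ∷ T)) + (- (+ 1)) * mobius S (λ T → g (false ∷ T))

-- The coefficient c_S of the monomial ∏_{i∈S} x_i in the unique
-- multilinear polynomial expansion
--   f(x) = Σ_{S ⊆ [b]} c_S ∏_{i∈S} x_i
-- over the integers, given by Möbius inversion:
--   c_S = Σ_{T ⊆ S} (-1)^{|S|-|T|} f(1_T).
coeff : ∀ {b} → (Vec Bool b → Bool) → Subset b → ℤ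
coeff f S = mobius S (λ T → bit (f T))

e : ∀ {b} → Fin b → Vec Bool b
e i = ⁅ i ⁆

𝟎 : ∀ {b} → Vec Bool b
𝟎 = replicate _ false

c₂ : ∀ {b} → (Vec Bool b → Bool) → Fin b → Fin b → ℤ
c₂ f i j = coeff f (⁅ i ⁆ ∪ ⁅ j ⁆)

{-# OPTIONS --safe #-}
module Submission where

-- Inclusion–exclusion on at most two coordinates gives
-- c_ij = f(e_i ∪ e_j) − f(e_i) − f(e_j) + f(0) = f(e_i ∪ e_j) − 2,
-- and f(e_i ∪ e_j) ∈ {0, 1}.

open import Defs
open import Data.Bool using (Bool; true; false)
open import Data.Nat using (ℕ; _≤_; s≤s)
open import Data.Integer using (ℤ; -_; +_; _+_; _-_; _*_)
open import Data.Integer.Properties using (-1*i≡-i)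
open import Data.Integer.Tactic.RingSolver using (solve-∀)
open import Data.Fin using (Fin; zero; suc; _<_)
open import Data.Fin.Subset using (⁅_⁆; _∪_; ⊥)
open import Data.Fin.Subset.Properties using (∪-identityˡ)
open import Data.Vec using (Vec; _∷_)
open import Data.Sum using (_⊎_; inj₁; inj₂)
open import Function using (_∘_)
open import Relation.Binary.PropositionalEquality using (_≡_; refl; cong)

mobius-⊥ : ∀ {b} (g : Vec Bool b → ℤ) → mobius ⊥ g ≡ g 𝟎
mobius-⊥ {ℕ.zero} g = refl
mobius-⊥ {ℕ.suc b} g = mobius-⊥ (g ∘ (false ∷_))

mobius-⁅⁆ : ∀ {b} (i : Fin b) (g : Vec Bool b → ℤ) →
            mobius ⁅ i ⁆ g ≡ g ⁅ i ⁆ - g 𝟎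
mobius-⁅⁆ zero g
  rewrite mobius-⊥ (g ∘ (true ∷_)) | mobius-⊥ (g ∘ (false ∷_)) =
  cong (_+_ (g ⁅ zero ⁆)) (-1*i≡-i (g 𝟎))
mobius-⁅⁆ (suc i) g = mobius-⁅⁆ i (g ∘ (false ∷_))

mobius-⁅⁆∪⁅⁆ : ∀ {b} {i j : Fin b} → i < j → (g : Vec Bool b → ℤ) →
               mobius (⁅ i ⁆ ∪ ⁅ j ⁆) g ≡ g (⁅ i ⁆ ∪ ⁅ j ⁆) - g ⁅ i ⁆ - g ⁅ j ⁆ + g 𝟎
mobius-⁅⁆∪⁅⁆ {i = zero} {suc j} _ g
  rewrite ∪-identityˡ ⁅ j ⁆
        | mobius-⁅⁆ j (g ∘ (true ∷_)) | mobius-⁅⁆ j (g ∘ (false ∷_)) =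
  expand (g (true ∷ ⁅ j ⁆)) (g (true ∷ ⊥)) (g (false ∷ ⁅ j ⁆)) (g (false ∷ ⊥))
  where
  expand : ∀ a b c d → (a - b) + - (+ 1) * (c - d) ≡ a - b - c + d
  expand = solve-∀
mobius-⁅⁆∪⁅⁆ {i = suc i} {suc j} (s≤s i<j) g = mobius-⁅⁆∪⁅⁆ i<j (g ∘ (false ∷_))

c₂-inclusion–exclusion : ∀ {b} (f : Vec Bool b → Bool) {i j : Fin b} → i < j →
  c₂ f i j ≡ bit (f (e i ∪ e j)) - bit (f (e i)) - bit (f (e j)) + bit (f 𝟎)
c₂-inclusion–exclusion f i<j = mobius-⁅⁆∪⁅⁆ i<j (bit ∘ f)

lemma10 : (b : ℕ) → 2 ≤ b → (f : Vec Bool b → Bool) →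
          f 𝟎 ≡ false → (∀ (i : Fin b) → f (e i) ≡ true) →
          ∀ (i j : Fin b) → i < j →
          (c₂ f i j ≡ - (+ 1)) ⊎ (c₂ f i j ≡ - (+ 2))
lemma10 _ _ f f𝟎≡0 fe≡1 i j i<j
  rewrite c₂-inclusion–exclusion f i<j | f𝟎≡0 | fe≡1 i | fe≡1 j
  with f (e i ∪ e j)
... | true  = inj₁ refl
... | false = inj₂ refl
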